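{- Let $\mathbb{H}$ be a gehm. Then $Z(\mathbb{H};u,v)=u^{d(\mathbb{H})-e(\mathbb{H})}Z(\mathbb{H}^*;1/u,v)$.
   Context: A gehm is a finite cubic graph whose edges are properly coloured with colours $b,g,r$, together with possibly some isolates ($g$-coloured edges meeting no vertex). A hyperedge is a $b$--$r$-cycle; a hyperface is a $b$--$g$-cycle or an isolate. $e(\mathbb{H})$ is the number of hyperedges, $d(e)$ is half the number of gehm-edges in the hyperedge $e$, $d(A)=\sum_{e\in A}d(e)$ and $d(\mathbb{H})=d(E(\mathbb{H}))$. The dual $\mathbb{H}^*$ is obtained by interchanging colours $b$ and $r$ on all gehm-edges. Suppressing a degree-two vertex: if its only edge is a loop, replace it and the loop by an isolate; otherwise contract one incident edge. Deleting a hyperedge $e$: delete its $b$-edges, contract its $r$-edges, suppress degree-two vertices. For $A\subseteq E(\mathbb{H})$, $\mathbb{H}_{|A}$ is obtained by deleting all hyperedges not in $A$ and $f(A)$ is the number of hyperfaces of $\mathbb{H}_{|A}$. The dichromatic polynomial is $Z(\mathbb{H};u,v)=\sum_{A\subseteq E(\mathbb{H})}u^{d(A)-|A|}v^{f(A)}$. -}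

module Defs where

open import Data.Bool using (Bool; true; false; T; not; _∧_; if_then_else_)
open import Data.Bool.Properties using (T?)
open import Data.Nat as ℕ using (ℕ; zero; suc; _∸_; _<ᵇ_)
open import Data.Fin using (Fin; toℕ)
open import Data.Fin.Properties using (_≟_)
open import Data.List using (List; []; _∷_; map; filter; length; foldr; upTo; allFin)
open import Data.Bool.ListAction using (any; all)
open import Data.Product using (_×_; _,_)
open import Data.Rational using (ℚ; 1ℚ; 0ℚ; _+_; _*_)
open import Relation.Binary.PropositionalEquality using (_≡_; _≢_)
open import Relation.Nullary.Decidable using (⌊_⌋)

-- Vertices: the elements v of Fin n with `present v ≡ true` (any finite
-- vertex set can be represented this way).  Since the colouring is a
-- proper 3-edge-colouring of a cubic graph, each vertex v has exactly
-- one edge of each colour; the b-edge at v is {v , b v}, etc.  So b, g,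
-- r are fixed-point-free involutions of the set of (present) vertices.
-- (Parallel edges, e.g. b v ≡ g v, are allowed; loops cannot occur since
-- the colouring is proper.)  `isolates` is the number of isolates.

record RawGehm (n : ℕ) : Set where
  field
    present  : Fin n → Bool
    b g r    : Fin n → Fin n
    isolates : ℕ

open RawGehm public

record IsGehm {n : ℕ} (H : RawGehm n) : Set where
  field
    b-closed : ∀ v → T (present H v) → T (present H (b H v))
    g-closed : ∀ v → T (present H v) → T (present H (g H v))
    r-closed : ∀ v → T (present H v) → T (present H (r H v))
    b-invol  : ∀ v → T (present H v) → b H (b H v) ≡ v
    g-invol  : ∀ v → T (present H v) → g H (g H v) ≡ v
    r-invol  : ∀ v → T (present H v) → r H (r H v) ≡ v
    b-nofix  : ∀ v → T (present H v) → b H v ≢ v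
    g-nofix  : ∀ v → T (present H v) → g H v ≢ v
    r-nofix  : ∀ v → T (present H v) → r H v ≢ v

_==_ : ∀ {n} → Fin n → Fin n → Bool
x == y = ⌊ x ≟ y ⌋

walk : ∀ {n} → (Fin n → Fin n) → (Fin n → Fin n) → ℕ → Fin n → Fin n
walk s t zero    v = v
walk s t (suc k) v = walk t s k (s v)

-- the vertices of the s–t cycle through v (a cycle has ≤ n vertices,
-- so 2n+1 positions of the alternating walk cover it)
cycleOf : ∀ {n} → (Fin n → Fin n) → (Fin n → Fin n) → Fin n → List (Fin n)
cycleOf {n} s t v = map (λ k → walk s t k v) (upTo (suc (2 ℕ.* n)))

inCycle : ∀ {n} → (Fin n → Fin n) → (Fin n → Fin n) → Fin n → Fin n → Bool
inCycle s t v w = any (_== w) (cycleOf s t v)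

isRep : ∀ {n} → (Fin n → Fin n) → (Fin n → Fin n) → Fin n → Bool
isRep s t v = all (λ w → not (toℕ w <ᵇ toℕ v)) (cycleOf s t v)

presentVs : ∀ {n} → RawGehm n → List (Fin n)
presentVs {n} H = filter (λ v → T? (present H v)) (allFin n)

cycleSize : ∀ {n} → RawGehm n → (Fin n → Fin n) → (Fin n → Fin n) → Fin n → ℕ
cycleSize H s t v = length (filter (λ w → T? (inCycle s t v w)) (presentVs H))

cycleReps : ∀ {n} → RawGehm n → (Fin n → Fin n) → (Fin n → Fin n) → List (Fin n)
cycleReps H s t = filter (λ v → T? (isRep s t v)) (presentVs H)

-- E(H): a hyperedge is represented by the least vertex of its b–r cycle
hyperedges : ∀ {n} → RawGehm n → List (Fin n)
hyperedges H = cycleReps H (b H) (r H)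

e : ∀ {n} → RawGehm n → ℕ
e H = length (hyperedges H)

-- number of gehm-edges of the hyperedge with representative x: every
-- vertex of the b–r cycle is incident with exactly one b-edge and one
-- r-edge of it, so the cycle has as many edges as vertices.
edgesOfHyperedge : ∀ {n} → RawGehm n → Fin n → ℕ
edgesOfHyperedge H x = cycleSize H (b H) (r H) x

dₑ : ∀ {n} → RawGehm n → Fin n → ℕ
dₑ H x = edgesOfHyperedge H x ℕ./ 2

dSet : ∀ {n} → RawGehm n → List (Fin n) → ℕ
dSet H A = foldr (λ x acc → dₑ H x ℕ.+ acc) 0 A

d : ∀ {n} → RawGehm n → ℕ
d H = dSet H (hyperedges H)

hyperfaces : ∀ {n} → RawGehm n → ℕ
hyperfaces H = length (cycleReps H (b H) (g H)) ℕ.+ isolates H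

dual : ∀ {n} → RawGehm n → RawGehm n
dual H = record { present = present H ; b = r H ; g = g H ; r = b H ; isolates = isolates H }

-- Let D be the vertex set of the hyperedge.  Deleting its b-edges and
-- contracting its r-edges turns each r-edge {y , r y} of D into a vertex
-- of degree two carrying the g-edges at y and r y; suppressing these
-- degree-two vertices (contracting an incident g-edge) produces:
--  * for a remaining vertex w, the new g-neighbour g(rg)^k w, where k is
--    least with g(rg)^k w ∉ D (k < n always suffices);
--  * for each g–r cycle lying entirely in D, a single vertex with a
--    g-loop, which is replaced by an isolate.
-- b and r are unchanged on the remaining vertices.

module Deletion {n : ℕ} (H : RawGehm n) (x : Fin n) where
  inD : Fin n → Bool
  inD = inCycle (b H) (r H) x

  newG-go : ℕ → Fin n → Fin n
  newG-go zero    y = y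
  newG-go (suc k) y = if inD y then newG-go k (g H (r H y)) else y

  newG : Fin n → Fin n
  newG w = newG-go n (g H w)

  newPresent : Fin n → Bool
  newPresent w = present H w ∧ not (inD w)

  newIsolates : ℕ
  newIsolates = length (filter (λ v → T? (all inD (cycleOf (g H) (r H) v)))
                               (cycleReps H (g H) (r H)))

deleteHyperedge : ∀ {n} → RawGehm n → Fin n → RawGehm n
deleteHyperedge H x = record
  { present  = newPresent
  ; b        = b H
  ; g        = newG
  ; r        = r H
  ; isolates = isolates H ℕ.+ newIsolates }
  where open Deletion H x

deleteHyperedges : ∀ {n} → RawGehm n → List (Fin n) → RawGehm n
deleteHyperedges H []       = H
deleteHyperedges H (x ∷ xs) = deleteHyperedges (deleteHyperedge H x) xs

subsetsWithComplement : ∀ {A : Set} → List A → List (List A × List A)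
subsetsWithComplement []       = ([] , []) ∷ []
subsetsWithComplement (x ∷ xs) =
  map (λ { (S , C) → (x ∷ S , C) }) (subsetsWithComplement xs) Data.List.++
  map (λ { (S , C) → (S , x ∷ C) }) (subsetsWithComplement xs)

infixr 8 _^_
_^_ : ℚ → ℕ → ℚ
p ^ zero  = 1ℚ
p ^ suc k = p * (p ^ k)

-- f(A) = number of hyperfaces of H|A, where H|A deletes the
-- hyperedges not in A (Ac is the complement of A in E(H)).
f : ∀ {n} → RawGehm n → List (Fin n) → ℕ
f H Ac = hyperfaces (deleteHyperedges H Ac)

-- Z(H;u,v) = Σ_{A ⊆ E(H)} u^{d(A)-|A|} v^{f(A)}   (d(A) ≥ |A| always)
Z : ∀ {n} → RawGehm n → ℚ → ℚ → ℚ
Z H u v = foldr _+_ 0ℚ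
  (map (λ { (A , Ac) → (u ^ (dSet H A ∸ length A)) * (v ^ f H Ac) })
       (subsetsWithComplement (hyperedges H)))

{-# OPTIONS --safe #-}

-- The dual H* has the same hyperedges as H, of the same sizes, so both
-- polynomials are sums over the subsets of E(H).  Pair the term of A in Z(H) with the
-- term of its complement Aᶜ in Z(H*): since (d(A) − |A|) + (d(Aᶜ) − |Aᶜ|) = d(H) − e(H),
-- the powers of u match, and it remains to see that deleting Aᶜ from H and deleting A
-- from H* leave the same number of hyperfaces.
--
-- Deleting the hyperedges of a set C one after another leaves, besides the old isolates,
-- as many hyperfaces as the pair of involutions (σ, g) of the original gehm has cycles,
-- where σ is r on the vertices of the hyperedges in C and b elsewhere: a σ–g cycle inside
-- a deleted hyperedge becomes an isolate, and every other σ–g cycle is shortened, by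
-- suppressing degree-two vertices, to exactly one b–g cycle of the result.  In H* the
-- colours b and r are exchanged, so deleting A from H* leads to the involution that is b
-- on A and r on Aᶜ, which is σ for C = Aᶜ because the hyperedges partition the vertices.

module Submission where

open import Defs
open import Algebra.Bundles using (CommutativeMonoid)
open import Data.Bool using (Bool; true; false; T; not; _∧_; _∨_; if_then_else_)
open import Data.Bool.ListAction using (any; all)
open import Data.Bool.Properties using (T?; T-∧; if-not)
open import Data.Empty using (⊥-elim)
open import Data.Fin using (Fin; toℕ)
open import Data.Fin.Properties using (toℕ-injective; toℕ<n; pigeonhole)
open import Data.List using (List; []; _∷_; _++_; map; filterᵇ; foldr; length; upTo; allFin)
open import Data.List.Membership.Propositional using (_∈_; find; lose)
open import Data.List.Membership.Propositional.Properties
  using (∈-filter⁺; ∈-filter⁻; ∈-map⁺; ∈-map⁻; ∈-upTo⁺; ∈-allFin; ∈-++⁻; ∈-++⁺ˡ; ∈-++⁺ʳ)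
open import Data.List.Properties using (filter-none; length-filter; filter-++; length-++; map-++)
open import Data.List.Relation.Binary.Permutation.Propositional using (_↭_; ↭-refl; ↭-trans; prep)
import Data.List.Relation.Binary.Permutation.Propositional.Properties as ↭
open ↭ using (shift; ↭-length; filter-↭)
import Data.List.Relation.Unary.All as All
import Data.List.Relation.Unary.All.Properties as All
open import Data.List.Relation.Unary.AllPairs using (_∷_)
open import Data.List.Relation.Unary.Any using (here; there)
import Data.List.Relation.Unary.Any.Properties as Any
open import Data.List.Relation.Unary.Unique.Propositional using (Unique)
import Data.List.Relation.Unary.Unique.Propositional.Properties as Unique
open import Data.Nat as ℕ using (ℕ; zero; suc; _+_; _∸_; _/_; _≤_; _<_; z≤n; s≤s; z<s; _≤?_; _<ᵇ_)
open import Data.Nat.DivMod using (m≥n⇒m/n>0)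
open import Data.Nat.GeneralisedArithmetic using (fold; fold-+)
open import Data.Nat.ListAction using (sum)
open import Data.Nat.ListAction.Properties using (sum-++; sum-↭)
open import Data.Nat.Properties
open import Data.Product using (_×_; _,_; proj₁; proj₂; ∃-syntax; swap)
open import Data.Rational using (ℚ; NonZero; 0ℚ; 1ℚ; _*_; 1/_) renaming (_+_ to _+ℚ_)
import Data.Rational.Properties as ℚ
open import Data.Sum using (_⊎_; inj₁; inj₂)
open import Data.Unit using (tt)
open import Function using (_∘_; Equivalence)
open import Relation.Binary using (tri<; tri≈; tri>)
open import Relation.Binary.PropositionalEquality
open import Relation.Nullary using (¬_; yes; no)
open import Relation.Nullary.Decidable using (toWitness; fromWitness; decidable-stable)

open import Algebra.Properties.CommutativeSemigroup
  (CommutativeMonoid.commutativeSemigroup ℚ.*-1-commutativeMonoid) using (interchange)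

private variable
  A : Set

-- Boolean filters and counting

T-∧⁻ : ∀ {a b} → T (a ∧ b) → T a × T b
T-∧⁻ = Equivalence.to T-∧

T-∧⁺ : ∀ {a b} → T a → T b → T (a ∧ b)
T-∧⁺ ta tb = Equivalence.from T-∧ (ta , tb)

T-not⁻ : ∀ {a} → T (not a) → ¬ T a
T-not⁻ {false} _ ()

T-not⁺ : ∀ {a} → ¬ T a → T (not a)
T-not⁺ {false} _  = tt
T-not⁺ {true}  ¬t = ¬t tt

T-injective : ∀ {a b} → (T a → T b) → (T b → T a) → a ≡ b
T-injective {false} {false} _ _ = refl
T-injective {false} {true}  _ f = ⊥-elim (f tt)
T-injective {true}  {false} f _ = ⊥-elim (f tt)
T-injective {true}  {true}  _ _ = refl

∈-filterᵇ⁻ : ∀ (p : A → Bool) {x xs} → x ∈ filterᵇ p xs → x ∈ xs × T (p x)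
∈-filterᵇ⁻ p = ∈-filter⁻ (T? ∘ p)

∈-filterᵇ⁺ : ∀ (p : A → Bool) {x xs} → x ∈ xs → T (p x) → x ∈ filterᵇ p xs
∈-filterᵇ⁺ p = ∈-filter⁺ (T? ∘ p)

filterᵇ-cong : ∀ {p q : A → Bool} xs → (∀ {x} → x ∈ xs → p x ≡ q x) →
               filterᵇ p xs ≡ filterᵇ q xs
filterᵇ-cong [] _ = refl
filterᵇ-cong {p = p} {q} (x ∷ xs) p≡q with p x | q x | p≡q (here refl)
... | false | false | _ = filterᵇ-cong xs (p≡q ∘ there)
... | true  | true  | _ = cong (x ∷_) (filterᵇ-cong xs (p≡q ∘ there))

filterᵇ-filterᵇ : ∀ (p q : A → Bool) xs →
                  filterᵇ q (filterᵇ p xs) ≡ filterᵇ (λ x → p x ∧ q x) xs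
filterᵇ-filterᵇ p q [] = refl
filterᵇ-filterᵇ p q (x ∷ xs) with p x
... | false = filterᵇ-filterᵇ p q xs
... | true with q x
...   | false = filterᵇ-filterᵇ p q xs
...   | true  = cong (x ∷_) (filterᵇ-filterᵇ p q xs)

length-filterᵇ-split : ∀ (p q : A → Bool) xs →
  length (filterᵇ q xs) ≡
  length (filterᵇ q (filterᵇ p xs)) + length (filterᵇ q (filterᵇ (not ∘ p) xs))
length-filterᵇ-split p q [] = refl
length-filterᵇ-split p q (x ∷ xs) with p x
... | true with q x
...   | true  = cong suc (length-filterᵇ-split p q xs)
...   | false = length-filterᵇ-split p q xs
length-filterᵇ-split p q (x ∷ xs) | false with q x
...   | true  = trans (cong suc (length-filterᵇ-split p q xs)) (sym (+-suc _ _))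
...   | false = length-filterᵇ-split p q xs

length-filterᵇ≡0 : ∀ (p : A → Bool) {xs} → (∀ {x} → x ∈ xs → ¬ T (p x)) →
                   length (filterᵇ p xs) ≡ 0
length-filterᵇ≡0 p none = cong length (filter-none (T? ∘ p) (All.tabulate none))

length-filterᵇ≡1 : ∀ (p : A → Bool) {xs x} → Unique xs →
                   (∀ {y z} → y ∈ xs → z ∈ xs → T (p y) → T (p z) → y ≡ z) →
                   x ∈ xs → T (p x) → length (filterᵇ p xs) ≡ 1
length-filterᵇ≡1 p {y ∷ xs} (y∉xs ∷ !xs) unique x∈ px with p y in py
... | true = cong suc (length-filterᵇ≡0 p λ z∈ pz →
               All.lookup y∉xs z∈ (unique (here refl) (there z∈) (subst T (sym py) tt) pz))
... | false with x∈
...   | here refl = ⊥-elim (subst T py px)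
...   | there x∈xs = length-filterᵇ≡1 p !xs (λ y∈ z∈ → unique (there y∈) (there z∈)) x∈xs px

record IsEquivalenceOn (E : A → A → Bool) (xs : List A) : Set where
  field
    reflexive  : ∀ {a} → a ∈ xs → T (E a a)
    symmetric  : ∀ {a b} → a ∈ xs → b ∈ xs → T (E a b) → T (E b a)
    transitive : ∀ {a b c} → a ∈ xs → b ∈ xs → c ∈ xs → T (E a b) → T (E b c) → T (E a c)

  restrict : ∀ {ys} → (∀ {x} → x ∈ ys → x ∈ xs) → IsEquivalenceOn E ys
  restrict ⊆ = record
    { reflexive  = reflexive ∘ ⊆
    ; symmetric  = λ a∈ b∈ → symmetric (⊆ a∈) (⊆ b∈)
    ; transitive = λ a∈ b∈ c∈ → transitive (⊆ a∈) (⊆ b∈) (⊆ c∈) }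

module _ (E : A → A → Bool) (p q : A → Bool) where

  private
    SameCount : List A → Set
    SameCount xs = length (filterᵇ p xs) ≡ length (filterᵇ q xs)

  length-filterᵇ-by-classes : ∀ xs → IsEquivalenceOn E xs →
    (∀ {a} → a ∈ xs → SameCount (filterᵇ (E a) xs)) → SameCount xs
  length-filterᵇ-by-classes xs = go (length xs) xs ≤-refl
    where
    go : ∀ m xs → length xs ≤ m → IsEquivalenceOn E xs →
         (∀ {a} → a ∈ xs → SameCount (filterᵇ (E a) xs)) → SameCount xs
    go _ [] _ _ _ = refl
    go (suc m) xs@(a ∷ ys) (s≤s |ys|≤m) equiv per-class = begin
        length (filterᵇ p xs)
      ≡⟨ length-filterᵇ-split (E a) p xs ⟩
        length (filterᵇ p (filterᵇ (E a) xs)) + length (filterᵇ p rest)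
      ≡⟨ cong₂ _+_ (per-class (here refl)) on-rest ⟩
        length (filterᵇ q (filterᵇ (E a) xs)) + length (filterᵇ q rest)
      ≡⟨ length-filterᵇ-split (E a) q xs ⟨
        length (filterᵇ q xs)
      ∎
      where
      open ≡-Reasoning
      open IsEquivalenceOn equiv
      rest = filterᵇ (not ∘ E a) xs
      ∈xs : ∀ {x} → x ∈ rest → x ∈ xs
      ∈xs = proj₁ ∘ ∈-filterᵇ⁻ (not ∘ E a)
      |rest|≤m : length rest ≤ m
      |rest|≤m with E a a | reflexive (here refl)
      ... | true | _ = ≤-trans (length-filter (T? ∘ not ∘ E a) ys) |ys|≤m
      class-in-rest : ∀ {b} → b ∈ rest → filterᵇ (E b) rest ≡ filterᵇ (E b) xs
      class-in-rest {b} b∈ = trans (filterᵇ-filterᵇ (not ∘ E a) (E b) xs) (filterᵇ-cong xs λ {x} x∈ →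
        T-injective (proj₂ ∘ T-∧⁻) λ Ebx → T-∧⁺ (T-not⁺ λ Eax →
          T-not⁻ (proj₂ (∈-filterᵇ⁻ (not ∘ E a) b∈))
                 (transitive (here refl) x∈ (∈xs b∈) Eax (symmetric (∈xs b∈) x∈ Ebx))) Ebx)
      on-rest : SameCount rest
      on-rest = go m rest |rest|≤m (restrict ∈xs) λ b∈ →
        subst SameCount (sym (class-in-rest b∈)) (per-class (∈xs b∈))

least-element : ∀ {n} (xs : List (Fin n)) {x} → x ∈ xs →
                ∃[ m ] (m ∈ xs × ∀ {y} → y ∈ xs → toℕ m ≤ toℕ y)
least-element (y ∷ []) _ = y , here refl , λ { (here refl) → ≤-refl }
least-element (y ∷ z ∷ xs) _ with least-element (z ∷ xs) (here refl)
... | m , m∈ , m≤ with toℕ y ≤? toℕ m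
...   | yes y≤m = y , here refl , λ { (here refl) → ≤-refl ; (there w∈) → ≤-trans y≤m (m≤ w∈) }
...   | no  y≰m = m , there m∈ , λ { (here refl) → <⇒≤ (≰⇒> y≰m) ; (there w∈) → m≤ w∈ }

2≤length : ∀ {xs : List A} {x y} → x ∈ xs → y ∈ xs → x ≢ y → 2 ≤ length xs
2≤length {xs = _ ∷ []}    (here refl) (here refl) x≢y = ⊥-elim (x≢y refl)
2≤length {xs = _ ∷ _ ∷ _} _ _ _ = s≤s (s≤s z≤n)

least-failure : (Q : ℕ → Bool) → ∀ m → ¬ T (Q m) →
                ∃[ k ] (k ≤ m × (∀ j → j < k → T (Q j)) × ¬ T (Q k))
least-failure Q m ¬Qm with T? (Q 0)
... | no ¬Q0 = 0 , z≤n , (λ _ ()) , ¬Q0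
least-failure Q zero    ¬Q0 | yes Q0 = ⊥-elim (¬Q0 Q0)
least-failure Q (suc m) ¬Qm | yes Q0 with least-failure (Q ∘ suc) m ¬Qm
... | k , k≤m , below , ¬Qk =
  suc k , s≤s k≤m , (λ { zero _ → Q0 ; (suc j) (s≤s j<k) → below j j<k }) , ¬Qk

any-filterᵇ : ∀ (p : A → Bool) xs → any p xs ≡ (0 <ᵇ length (filterᵇ p xs))
any-filterᵇ p [] = refl
any-filterᵇ p (x ∷ xs) with p x
... | true  = refl
... | false = any-filterᵇ p xs

any-cong : ∀ {p q : A → Bool} xs → (∀ {x} → x ∈ xs → p x ≡ q x) → any p xs ≡ any q xs
any-cong []       _   = refl
any-cong (x ∷ xs) p≡q = cong₂ _∨_ (p≡q (here refl)) (any-cong xs (p≡q ∘ there))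

0<ᵇ-complement : ∀ m k → m + k ≡ 1 → (0 <ᵇ m) ≡ not (0 <ᵇ k)
0<ᵇ-complement 0 1 _ = refl
0<ᵇ-complement 1 0 _ = refl
0<ᵇ-complement 0 (suc (suc _)) ()
0<ᵇ-complement 1 (suc _) ()
0<ᵇ-complement (suc (suc _)) _ ()

subsetsWithComplement-↭ : ∀ (xs : List A) {S C} → (S , C) ∈ subsetsWithComplement xs → S ++ C ↭ xs
subsetsWithComplement-↭ [] (here refl) = ↭-refl
subsetsWithComplement-↭ (x ∷ xs) S,C∈ with ∈-++⁻ (map _ (subsetsWithComplement xs)) S,C∈
... | inj₁ ∈left with (S , C) , S,C∈′ , refl ← ∈-map⁻ _ ∈left =
  prep x (subsetsWithComplement-↭ xs S,C∈′)
... | inj₂ ∈right with (S , C) , S,C∈′ , refl ← ∈-map⁻ _ ∈right =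
  ↭-trans (shift x S C) (prep x (subsetsWithComplement-↭ xs S,C∈′))

length-filterᵇ-↭ : ∀ (p : A → Bool) {S C xs} → S ++ C ↭ xs →
                   length (filterᵇ p S) + length (filterᵇ p C) ≡ length (filterᵇ p xs)
length-filterᵇ-↭ p {S} {C} {xs} S++C↭xs = begin
  length (filterᵇ p S) + length (filterᵇ p C)  ≡⟨ length-++ (filterᵇ p S) ⟨
  length (filterᵇ p S ++ filterᵇ p C)          ≡⟨ cong length (filter-++ (T? ∘ p) S C) ⟨
  length (filterᵇ p (S ++ C))                  ≡⟨ ↭-length (filter-↭ (T? ∘ p) S++C↭xs) ⟩
  length (filterᵇ p xs)                        ∎
  where open ≡-Reasoning

-- Orbits of a pair of involutions

fold-suc : ∀ (f : A → A) x k → fold (f x) f k ≡ f (fold x f k)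
fold-suc f x zero    = refl
fold-suc f x (suc k) = cong f (fold-suc f x k)

data Reach {n} (s t : Fin n → Fin n) (v : Fin n) : Fin n → Set where
  rfl    : Reach s t v v
  s-step : ∀ {w} → Reach s t v w → Reach s t v (s w)
  t-step : ∀ {w} → Reach s t v w → Reach s t v (t w)

module _ {n : ℕ} {s t : Fin n → Fin n} where

  reach-trans : ∀ {u v w} → Reach s t u v → Reach s t v w → Reach s t u w
  reach-trans u⇝v rfl          = u⇝v
  reach-trans u⇝v (s-step v⇝w) = s-step (reach-trans u⇝v v⇝w)
  reach-trans u⇝v (t-step v⇝w) = t-step (reach-trans u⇝v v⇝w)

  reach-swap : ∀ {v w} → Reach s t v w → Reach t s v w
  reach-swap rfl          = rfl
  reach-swap (s-step v⇝w) = t-step (reach-swap v⇝w)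
  reach-swap (t-step v⇝w) = s-step (reach-swap v⇝w)

walk-reach : ∀ {n} k (s t : Fin n → Fin n) v → Reach s t v (walk s t k v)
walk-reach zero    s t v = rfl
walk-reach (suc k) s t v = reach-trans (s-step rfl) (reach-swap (walk-reach k t s (s v)))

double : ℕ → ℕ
double zero    = zero
double (suc k) = suc (suc (double k))

walk-double : ∀ {n} (s t : Fin n → Fin n) k v → walk s t (double k) v ≡ fold v (t ∘ s) k
walk-double s t zero    v = refl
walk-double s t (suc k) v = trans (walk-double s t k (t (s v))) (fold-suc (t ∘ s) v k)

walk-suc-double : ∀ {n} (s t : Fin n → Fin n) k v →
                  walk s t (suc (double k)) v ≡ s (fold v (t ∘ s) k)
walk-suc-double s t zero    v = refl
walk-suc-double s t (suc k) v =
  trans (walk-suc-double s t k (t (s v))) (cong s (fold-suc (t ∘ s) v k))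

suc-double< : ∀ {k m} → k < m → suc (double k) < suc (2 ℕ.* m)
suc-double< {suc k} {suc m} (s≤s k<m) =
  ≤-trans (s≤s (s≤s (suc-double< k<m))) (≤-reflexive (cong (suc ∘ suc) (sym (+-suc m (m + 0)))))
suc-double< {zero} {suc m} _ = s≤s (s≤s z≤n)

module _ {n : ℕ} {s t : Fin n → Fin n} {v : Fin n} where

  ∈-cycleOf⁻ : ∀ {w} → w ∈ cycleOf s t v → Reach s t v w
  ∈-cycleOf⁻ w∈ = let k , _ , w≡ = ∈-map⁻ (λ k → walk s t k v) {xs = upTo (suc (2 ℕ.* n))} w∈ in
    subst (Reach s t v) (sym w≡) (walk-reach k s t v)

  ∈-cycleOf⁺ : ∀ {k} → k < suc (2 ℕ.* n) → walk s t k v ∈ cycleOf s t v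
  ∈-cycleOf⁺ k< = ∈-map⁺ (λ k → walk s t k v) (∈-upTo⁺ k<)

  ∈-cycleOf⇒inCycle : ∀ {w} → w ∈ cycleOf s t v → T (inCycle s t v w)
  ∈-cycleOf⇒inCycle w∈ = Any.any⁺ _ (lose w∈ (fromWitness refl))

  inCycle⇒reach : ∀ {w} → T (inCycle s t v w) → Reach s t v w
  inCycle⇒reach {w} w∈ with x , x∈ , x≡w ← find (Any.any⁻ (_== w) (cycleOf s t v) w∈) =
    subst (Reach s t v) (toWitness x≡w) (∈-cycleOf⁻ x∈)

  all-cycleOf⁺ : ∀ (q : Fin n → Bool) → (∀ {w} → Reach s t v w → T (q w)) →
                 T (all q (cycleOf s t v))
  all-cycleOf⁺ q h = All.all⁻ q (All.tabulate (h ∘ ∈-cycleOf⁻))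

  least⇒isRep : (∀ {w} → Reach s t v w → toℕ v ≤ toℕ w) → T (isRep s t v)
  least⇒isRep v≤ = all-cycleOf⁺ _ λ v⇝w → T-not⁺ λ w<v → <⇒≱ (<ᵇ⇒< _ _ w<v) (v≤ v⇝w)

record InvolutionOn {n} (P : Fin n → Bool) (s : Fin n → Fin n) : Set where
  field
    closed     : ∀ {v} → T (P v) → T (P (s v))
    involutive : ∀ {v} → T (P v) → s (s v) ≡ v

module Orbits {n : ℕ} {P : Fin n → Bool} {s t : Fin n → Fin n}
              (s-inv : InvolutionOn P s) (t-inv : InvolutionOn P t) where

  open InvolutionOn s-inv renaming (closed to s-closed; involutive to s-involutive)
  open InvolutionOn t-inv renaming (closed to t-closed; involutive to t-involutive)

  reach-present : ∀ {v w} → T (P v) → Reach s t v w → T (P w)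
  reach-present pv rfl          = pv
  reach-present pv (s-step v⇝w) = s-closed (reach-present pv v⇝w)
  reach-present pv (t-step v⇝w) = t-closed (reach-present pv v⇝w)

  reach-sym : ∀ {v w} → T (P v) → Reach s t v w → Reach s t w v
  reach-sym pv rfl = rfl
  reach-sym pv (s-step {w} v⇝w) = reach-trans
    (subst (Reach s t (s w)) (s-involutive (reach-present pv v⇝w)) (s-step rfl)) (reach-sym pv v⇝w)
  reach-sym pv (t-step {w} v⇝w) = reach-trans
    (subst (Reach s t (t w)) (t-involutive (reach-present pv v⇝w)) (t-step rfl)) (reach-sym pv v⇝w)

  reach-resp : ∀ {s′ v w} → (∀ {u} → T (P u) → s u ≡ s′ u) → T (P v) →
               Reach s t v w → Reach s′ t v w
  reach-resp s≗s′ pv rfl = rfl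
  reach-resp {s′} {v} s≗s′ pv (s-step v⇝w) =
    subst (Reach s′ t v) (sym (s≗s′ (reach-present pv v⇝w))) (s-step (reach-resp s≗s′ pv v⇝w))
  reach-resp s≗s′ pv (t-step v⇝w) = t-step (reach-resp s≗s′ pv v⇝w)

  rotate : Fin n → Fin n
  rotate = t ∘ s

  rotate-present : ∀ {v} k → T (P v) → T (P (fold v rotate k))
  rotate-present zero    pv = pv
  rotate-present (suc k) pv = t-closed (s-closed (rotate-present k pv))

  rotate-injective : ∀ {v w} k → T (P v) → T (P w) → fold v rotate k ≡ fold w rotate k → v ≡ w
  rotate-injective zero    _ _ eq = eq
  rotate-injective (suc k) pv pw eq = rotate-injective k pv pw (begin
      fold _ rotate k                 ≡⟨ s-involutive (rotate-present k pv) ⟨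
      s (s (fold _ rotate k))         ≡⟨ cong s (t-involutive (s-closed (rotate-present k pv))) ⟨
      s (t (rotate (fold _ rotate k))) ≡⟨ cong (s ∘ t) eq ⟩
      s (t (rotate (fold _ rotate k))) ≡⟨ cong s (t-involutive (s-closed (rotate-present k pw))) ⟩
      s (s (fold _ rotate k))         ≡⟨ s-involutive (rotate-present k pw) ⟩
      fold _ rotate k                 ∎)
    where open ≡-Reasoning

  period : ∀ {v} → T (P v) → ∃[ p ] (0 < p × p ≤ n × fold v rotate p ≡ v)
  period {v} pv with i , j , i<j , eq ← pigeonhole (n<1+n n) (λ i → fold v rotate (toℕ i)) =
    p , m<n⇒0<n∸m i<j , ≤-trans (m∸n≤m (toℕ j) (toℕ i)) (≤-pred (toℕ<n j)) ,
    sym (rotate-injective (toℕ i) pv (rotate-present p pv) (trans eq (begin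
      fold v rotate (toℕ j)           ≡⟨ cong (fold v rotate) (m+[n∸m]≡n (<⇒≤ i<j)) ⟨
      fold v rotate (toℕ i + p)       ≡⟨ fold-+ v rotate (toℕ i) ⟩
      fold (fold v rotate p) rotate (toℕ i) ∎)))
    where
    open ≡-Reasoning
    p = toℕ j ∸ toℕ i

  OnRotation : ℕ → Fin n → Fin n → Set
  OnRotation p v w = ∃[ k ] (k < p × (w ≡ fold v rotate k ⊎ w ≡ s (fold v rotate k)))

  reach⇒onRotation : ∀ {v w} p → T (P v) → 0 < p → fold v rotate p ≡ v →
                     Reach s t v w → OnRotation p v w
  reach⇒onRotation p pv 0<p _ rfl = 0 , 0<p , inj₁ refl
  reach⇒onRotation p pv 0<p per (s-step v⇝w) with reach⇒onRotation p pv 0<p per v⇝w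
  ... | k , k<p , inj₁ refl = k , k<p , inj₂ refl
  ... | k , k<p , inj₂ refl = k , k<p , inj₁ (s-involutive (rotate-present k pv))
  reach⇒onRotation {v} p@(suc p′) pv 0<p per (t-step v⇝w) with reach⇒onRotation p pv 0<p per v⇝w
  ... | zero , _ , inj₁ refl =
    p′ , n<1+n p′ , inj₂ (trans (cong t (sym per)) (t-involutive (s-closed (rotate-present p′ pv))))
  ... | suc k , k<p , inj₁ refl =
    k , <-trans (n<1+n k) k<p , inj₂ (t-involutive (s-closed (rotate-present k pv)))
  ... | k , k<p , inj₂ refl with m≤n⇒m<n∨m≡n k<p
  ...   | inj₁ 1+k<p = suc k , 1+k<p , inj₁ refl
  ...   | inj₂ 1+k≡p = 0 , 0<p , inj₁ (trans (cong (fold v rotate) 1+k≡p) per)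

  reach⇒∈cycleOf : ∀ {v w} → T (P v) → Reach s t v w → w ∈ cycleOf s t v
  reach⇒∈cycleOf {v} pv v⇝w with p , 0<p , p≤n , per ← period pv
                          with reach⇒onRotation p pv 0<p per v⇝w
  ... | k , k<p , inj₁ refl = subst (_∈ cycleOf s t v) (walk-double s t k v)
                                (∈-cycleOf⁺ (<-trans (n<1+n _) (suc-double< (<-≤-trans k<p p≤n))))
  ... | k , k<p , inj₂ refl = subst (_∈ cycleOf s t v) (walk-suc-double s t k v)
                                (∈-cycleOf⁺ (suc-double< (<-≤-trans k<p p≤n)))

  reach⇒inCycle : ∀ {v w} → T (P v) → Reach s t v w → T (inCycle s t v w)
  reach⇒inCycle pv = ∈-cycleOf⇒inCycle ∘ reach⇒∈cycleOf pv

  all-cycleOf⁻ : ∀ {v w} (q : Fin n → Bool) → T (P v) → T (all q (cycleOf s t v)) →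
                 Reach s t v w → T (q w)
  all-cycleOf⁻ q pv all-q = All.lookup (All.all⁺ q _ all-q) ∘ reach⇒∈cycleOf pv

  isRep⇒least : ∀ {v w} → T (P v) → T (isRep s t v) → Reach s t v w → toℕ v ≤ toℕ w
  isRep⇒least pv rep v⇝w = ≮⇒≥ (T-not⁻ (all-cycleOf⁻ _ pv rep v⇝w) ∘ <⇒<ᵇ)

  isRep-unique : ∀ {v w} → T (P v) → T (P w) → T (isRep s t v) → T (isRep s t w) →
                 Reach s t v w → v ≡ w
  isRep-unique pv pw rep-v rep-w v⇝w = toℕ-injective
    (≤-antisym (isRep⇒least pv rep-v v⇝w) (isRep⇒least pw rep-w (reach-sym pv v⇝w)))

  isRep-exists : ∀ {v} → T (P v) → ∃[ m ] (T (P m) × T (isRep s t m) × Reach s t m v)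
  isRep-exists {v} pv = m , pm , least⇒isRep m-least , reach-sym pv v⇝m
    where
    orbit = filterᵇ (inCycle s t v) (allFin n)
    least = least-element orbit (∈-filterᵇ⁺ (inCycle s t v) (∈-allFin v) (reach⇒inCycle pv rfl))
    m = proj₁ least
    v⇝m = inCycle⇒reach (proj₂ (∈-filterᵇ⁻ (inCycle s t v) {xs = allFin n} (proj₁ (proj₂ least))))
    pm = reach-present pv v⇝m
    m-least : ∀ {w} → Reach s t m w → toℕ m ≤ toℕ w
    m-least m⇝w = proj₂ (proj₂ least)
      (∈-filterᵇ⁺ (inCycle s t v) (∈-allFin _) (reach⇒inCycle pv (reach-trans v⇝m m⇝w)))

  rotate-back : ∀ {u} → T (P u) → ∀ j i →
                fold (t (fold u rotate (suc (j + i)))) rotate j ≡ s (fold u rotate i)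
  rotate-back pu zero i = t-involutive (s-closed (rotate-present i pu))
  rotate-back {u} pu (suc j) i = begin
      fold (t (fold u rotate (suc (suc j + i)))) rotate (suc j)  ≡⟨ fold-suc rotate _ j ⟨
      fold (rotate (t (rotate (fold u rotate (suc (j + i)))))) rotate j
        ≡⟨ cong (λ z → fold (t (s z)) rotate j) (t-involutive (s-closed (rotate-present (suc (j + i)) pu))) ⟩
      fold (t (s (s (fold u rotate (suc (j + i)))))) rotate j
        ≡⟨ cong (λ z → fold (t z) rotate j) (s-involutive (rotate-present (suc (j + i)) pu)) ⟩
      fold (t (fold u rotate (suc (j + i)))) rotate j             ≡⟨ rotate-back pu j i ⟩
      s (fold u rotate i)                                         ∎
    where open ≡-Reasoning

  rotate-back-to-start : ∀ {u} → T (P u) → ∀ k → fold (t (fold u rotate k)) rotate k ≡ t u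
  rotate-back-to-start pu zero = refl
  rotate-back-to-start {u} pu (suc k) = begin
      rotate (fold (t (fold u rotate (suc k))) rotate k)
        ≡⟨ cong (λ i → rotate (fold (t (fold u rotate (suc i))) rotate k)) (+-identityʳ k) ⟨
      rotate (fold (t (fold u rotate (suc (k + 0)))) rotate k)  ≡⟨ cong rotate (rotate-back pu k 0) ⟩
      t (s (s u))                                               ≡⟨ cong t (s-involutive pu) ⟩
      t u                                                       ∎
    where open ≡-Reasoning

module _ {n : ℕ} {P : Fin n → Bool} {s t : Fin n → Fin n}
         (s-inv : InvolutionOn P s) (t-inv : InvolutionOn P t) where

  private
    module ST = Orbits s-inv t-inv
    module TS = Orbits t-inv s-inv

  inCycle-swap : ∀ {v w} → T (P v) → inCycle t s v w ≡ inCycle s t v w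
  inCycle-swap pv = T-injective (ST.reach⇒inCycle pv ∘ reach-swap ∘ inCycle⇒reach)
                                (TS.reach⇒inCycle pv ∘ reach-swap ∘ inCycle⇒reach)

  isRep-swap : ∀ {v} → T (P v) → isRep t s v ≡ isRep s t v
  isRep-swap pv = T-injective (λ rep → least⇒isRep (TS.isRep⇒least pv rep ∘ reach-swap))
                              (λ rep → least⇒isRep (ST.isRep⇒least pv rep ∘ reach-swap))

module _ {n : ℕ} {P : Fin n → Bool} {s s′ t : Fin n → Fin n}
         (s-inv : InvolutionOn P s) (s′-inv : InvolutionOn P s′) (t-inv : InvolutionOn P t) where

  private
    module ST  = Orbits s-inv t-inv
    module S′T = Orbits s′-inv t-inv

  isRep-cong : (∀ {u} → T (P u) → s u ≡ s′ u) → ∀ {v} → T (P v) → isRep s t v ≡ isRep s′ t v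
  isRep-cong s≗s′ pv = T-injective
    (λ rep → least⇒isRep (ST.isRep⇒least pv rep ∘ S′T.reach-resp (sym ∘ s≗s′) pv))
    (λ rep → least⇒isRep (S′T.isRep⇒least pv rep ∘ ST.reach-resp s≗s′ pv))

-- Deleting one hyperedge

-- The gehm axioms without fixed-point-freeness: this weaker structure survives
-- the deletion of hyperedges, and it is all that the counting below uses.
record IsPregehm {n} (K : RawGehm n) : Set where
  field
    b-inv : InvolutionOn (present K) (b K)
    g-inv : InvolutionOn (present K) (g K)
    r-inv : InvolutionOn (present K) (r K)

isGehm⇒isPregehm : ∀ {n} {H : RawGehm n} → IsGehm H → IsPregehm H
isGehm⇒isPregehm isGehm = record
  { b-inv = record { closed = b-closed _ ; involutive = b-invol _ }
  ; g-inv = record { closed = g-closed _ ; involutive = g-invol _ }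
  ; r-inv = record { closed = r-closed _ ; involutive = r-invol _ } }
  where open IsGehm isGehm

∈-presentVs⁻ : ∀ {n} (K : RawGehm n) {v} → v ∈ presentVs K → T (present K v)
∈-presentVs⁻ {n} K = proj₂ ∘ ∈-filterᵇ⁻ (present K) {xs = allFin n}

∈-presentVs⁺ : ∀ {n} (K : RawGehm n) {v} → T (present K v) → v ∈ presentVs K
∈-presentVs⁺ K = ∈-filterᵇ⁺ (present K) (∈-allFin _)

presentVs-unique : ∀ {n} (K : RawGehm n) → Unique (presentVs K)
presentVs-unique {n} K = Unique.filter⁺ (T? ∘ present K) (Unique.allFin⁺ n)

-- Assumed by the deletion lemmas instead of presence of x, since unlike presence it is
-- plainly inherited by the graph left after deleting other hyperedges.
HyperedgeClosed : ∀ {n} → RawGehm n → Fin n → Set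
HyperedgeClosed K x = ∀ {w} → T (present K w) → T (inCycle (b K) (r K) x w) →
                      T (inCycle (b K) (r K) x (b K w)) × T (inCycle (b K) (r K) x (r K w))

hyperedgeClosed : ∀ {n} {K : RawGehm n} → IsPregehm K → ∀ {x} → T (present K x) → HyperedgeClosed K x
hyperedgeClosed pre px _ w∈ = let x⇝w = inCycle⇒reach w∈ in
  BR.reach⇒inCycle px (s-step x⇝w) , BR.reach⇒inCycle px (t-step x⇝w)
  where module BR = Orbits (IsPregehm.b-inv pre) (IsPregehm.r-inv pre)

module DeleteOne {n : ℕ} (K : RawGehm n) (pre : IsPregehm K) (x : Fin n)
                 (x-closed : HyperedgeClosed K x) where

  open IsPregehm pre
  open InvolutionOn
  open Deletion K x public

  P = present K
  K′ = deleteHyperedge K x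
  P′ = present K′

  ∉D-r : ∀ {w} → T (P w) → ¬ T (inD w) → ¬ T (inD (r K w))
  ∉D-r pw w∉ rw∈ = w∉ (subst (T ∘ inD) (r-inv .involutive pw) (proj₂ (x-closed (r-inv .closed pw) rw∈)))

  ∉D-b : ∀ {w} → T (P w) → ¬ T (inD w) → ¬ T (inD (b K w))
  ∉D-b pw w∉ bw∈ = w∉ (subst (T ∘ inD) (b-inv .involutive pw) (proj₁ (x-closed (b-inv .closed pw) bw∈)))

  present′⁻ : ∀ {w} → T (P′ w) → T (P w) × ¬ T (inD w)
  present′⁻ pw = let pw , w∉ = T-∧⁻ pw in pw , T-not⁻ w∉

  present′⁺ : ∀ {w} → T (P w) → ¬ T (inD w) → T (P′ w)
  present′⁺ pw w∉ = T-∧⁺ pw (T-not⁺ w∉)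

  module RG = Orbits r-inv g-inv
  open RG using (rotate; rotate-present)

  ExitsAt : ℕ → Fin n → Set
  ExitsAt k y = (∀ j → j < k → T (inD (fold y rotate j))) × ¬ T (inD (fold y rotate k))

  exitsAt-unique : ∀ {k k′ y} → ExitsAt k y → ExitsAt k′ y → k ≡ k′
  exitsAt-unique {k} {k′} (before , at) (before′ , at′) with <-cmp k k′
  ... | tri< k<k′ _ _ = ⊥-elim (at (before′ k k<k′))
  ... | tri≈ _ k≡k′ _ = k≡k′
  ... | tri> _ _ k′<k = ⊥-elim (at′ (before k′ k′<k))

  newG-go-exit : ∀ {k m y} → ExitsAt k y → k ≤ m → newG-go m y ≡ fold y rotate k
  newG-go-exit {zero} {zero} _ _ = refl
  newG-go-exit {zero} {suc m} {y} (_ , y∉) _ with inD y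
  ... | false = refl
  ... | true  = ⊥-elim (y∉ tt)
  newG-go-exit {suc k} {suc m} {y} (before , at) (s≤s k≤m) with inD y | before 0 z<s
  ... | true | _ = trans (newG-go-exit (before′ , at′) k≤m) (fold-suc rotate y k)
    where
    before′ : ∀ j → j < k → T (inD (fold (rotate y) rotate j))
    before′ j j<k = subst (T ∘ inD) (sym (fold-suc rotate y j)) (before (suc j) (s≤s j<k))
    at′ : ¬ T (inD (fold (rotate y) rotate k))
    at′ = at ∘ subst (T ∘ inD) (fold-suc rotate y k)

  exit-exists : ∀ {w} → T (P w) → ¬ T (inD w) → ∃[ k ] (k < n × ExitsAt k (g K w))
  exit-exists {w} pw w∉ with suc p , _ , p<n , per ← RG.period (r-inv .closed pw) =
    let k , k≤p , before , at = least-failure (λ j → inD (fold (g K w) rotate j)) p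
                                  (∉D-r pw w∉ ∘ subst (T ∘ inD) reaches-rw)
    in k , <-≤-trans (s≤s k≤p) p<n , before , at
    where
    reaches-rw : fold (g K w) rotate p ≡ r K w
    reaches-rw = begin
      fold (g K w) rotate p             ≡⟨ cong (λ z → fold (g K z) rotate p) (r-inv .involutive pw) ⟨
      fold (rotate (r K w)) rotate p    ≡⟨ fold-suc rotate (r K w) p ⟩
      fold (r K w) rotate (suc p)       ≡⟨ per ⟩
      r K w                             ∎
      where open ≡-Reasoning

  newG-exit : ∀ {w k} → T (P w) → ¬ T (inD w) → ExitsAt k (g K w) → newG w ≡ fold (g K w) rotate k
  newG-exit pw w∉ exit with k₀ , k₀<n , exit₀ ← exit-exists pw w∉
    rewrite exitsAt-unique exit exit₀ = newG-go-exit exit₀ (<⇒≤ k₀<n)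

  newG-spec : ∀ {w} → T (P w) → ¬ T (inD w) →
              ∃[ k ] (ExitsAt k (g K w) × newG w ≡ fold (g K w) rotate k)
  newG-spec pw w∉ with k , _ , exit ← exit-exists pw w∉ = k , exit , newG-exit pw w∉ exit

  newG-closed : ∀ {w} → T (P′ w) → T (P′ (newG w))
  newG-closed pw′ with pw , w∉ ← present′⁻ pw′ with k , (_ , at) , eq ← newG-spec pw w∉ =
    subst (T ∘ P′) (sym eq) (present′⁺ (rotate-present k (g-inv .closed pw)) at)

  -- Walking back from newG w along the same stretch of D ends at w.
  newG-involutive : ∀ {w} → T (P′ w) → newG (newG w) ≡ w
  newG-involutive {w} pw′ with pw , w∉ ← present′⁻ pw′ with k , (before , at) , eq ← newG-spec pw w∉ =
    trans (cong newG eq) (trans (newG-exit pw-end at (before-back , at-back)) back-to-w)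
    where
    pgw = g-inv .closed pw
    pw-end = rotate-present k pgw
    back-to-w : fold (g K (fold (g K w) rotate k)) rotate k ≡ w
    back-to-w = trans (RG.rotate-back-to-start pgw k) (g-inv .involutive pw)
    before-back : ∀ j → j < k → T (inD (fold (g K (fold (g K w) rotate k)) rotate j))
    before-back j j<k with i ← k ∸ suc j | refl ← m+[n∸m]≡n j<k =
      subst (T ∘ inD) (sym (RG.rotate-back pgw j i))
            (proj₂ (x-closed (rotate-present i pgw) (before i (s≤s (m≤n+m i j)))))
    at-back : ¬ T (inD (fold (g K (fold (g K w) rotate k)) rotate k))
    at-back = w∉ ∘ subst (T ∘ inD) back-to-w

  isPregehm′ : IsPregehm K′
  isPregehm′ = record
    { b-inv = record { closed     = λ pw′ → let pw , w∉ = present′⁻ pw′ in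
                                            present′⁺ (b-inv .closed pw) (∉D-b pw w∉)
                     ; involutive = b-inv .involutive ∘ proj₁ ∘ present′⁻ }
    ; g-inv = record { closed = newG-closed ; involutive = newG-involutive }
    ; r-inv = record { closed     = λ pw′ → let pw , w∉ = present′⁻ pw′ in
                                            present′⁺ (r-inv .closed pw) (∉D-r pw w∉)
                     ; involutive = r-inv .involutive ∘ proj₁ ∘ present′⁻ } }

  module Splice (c′ : Fin n → Fin n) (c′-inv : InvolutionOn P′ c′) where

    c : Fin n → Fin n
    c v = if inD v then r K v else c′ v

    c-∈D : ∀ {v} → T (inD v) → c v ≡ r K v
    c-∈D {v} v∈ with inD v
    ... | true = refl

    c-∉D : ∀ {v} → ¬ T (inD v) → c v ≡ c′ v
    c-∉D {v} v∉ with inD v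
    ... | true  = ⊥-elim (v∉ tt)
    ... | false = refl

    c-inv : InvolutionOn P c
    c-inv .closed {v} pv with T? (inD v)
    ... | yes v∈ = subst (T ∘ P) (sym (c-∈D v∈)) (r-inv .closed pv)
    ... | no  v∉ = subst (T ∘ P) (sym (c-∉D v∉))
                         (proj₁ (present′⁻ (c′-inv .closed (present′⁺ pv v∉))))
    c-inv .involutive {v} pv with T? (inD v)
    ... | yes v∈ = trans (cong c (c-∈D v∈)) (trans (c-∈D (proj₂ (x-closed pv v∈))) (r-inv .involutive pv))
    ... | no  v∉ = trans (cong c (c-∉D v∉))
                     (trans (c-∉D (proj₂ (present′⁻ (c′-inv .closed (present′⁺ pv v∉)))))
                            (c′-inv .involutive (present′⁺ pv v∉)))

    module CG  = Orbits c-inv g-inv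
    module C′G′ = Orbits c′-inv (IsPregehm.g-inv isPregehm′)
    module GR  = Orbits g-inv r-inv

    stretch-reach : ∀ {v y} j → Reach c (g K) v y → (∀ i → i < j → T (inD (fold y rotate i))) →
                    Reach c (g K) v (fold y rotate j)
    stretch-reach zero    v⇝y _      = v⇝y
    stretch-reach {v} (suc j) v⇝y inside = t-step (subst (Reach c (g K) v) (c-∈D (inside j (n<1+n j)))
      (s-step (stretch-reach j v⇝y (λ i i<j → inside i (m<n⇒m<1+n i<j)))))

    reach′⇒reach : ∀ {v w} → T (P′ v) → Reach c′ newG v w → Reach c (g K) v w
    reach′⇒reach pv′ rfl = rfl
    reach′⇒reach {v} pv′ (s-step {u} v⇝u) =
      subst (Reach c (g K) v) (c-∉D (proj₂ (present′⁻ (C′G′.reach-present pv′ v⇝u))))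
            (s-step (reach′⇒reach pv′ v⇝u))
    reach′⇒reach {v} pv′ (t-step {u} v⇝u)
      with pu , u∉ ← present′⁻ (C′G′.reach-present pv′ v⇝u)
      with k , (before , _) , eq ← newG-spec pu u∉ =
      subst (Reach c (g K) v) (sym eq) (stretch-reach k (t-step (reach′⇒reach pv′ v⇝u)) before)

    InStretch : Fin n → Fin n → Set
    InStretch u w = ∃[ j ] ((∀ i → i ≤ j → T (inD (fold (g K u) rotate i))) ×
                            (w ≡ fold (g K u) rotate j ⊎ w ≡ r K (fold (g K u) rotate j)))

    -- The invariant of a c–g walk from a vertex of K′: it is at a vertex of K′
    -- reachable in K′, or inside D on the stretch that a g-edge at such a vertex enters.
    Traced : Fin n → Fin n → Set
    Traced v w = (T (P′ w) × Reach c′ newG v w) ⊎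
                 ∃[ u ] (T (P′ u) × Reach c′ newG v u × InStretch u w)

    traced-c : ∀ {v w} → Traced v w → Traced v (c w)
    traced-c {v} {w} (inj₁ (pw′ , v⇝w)) = let w∉ = proj₂ (present′⁻ pw′) in
      inj₁ ( subst (T ∘ P′) (sym (c-∉D w∉)) (c′-inv .closed pw′)
           , subst (Reach c′ newG v) (sym (c-∉D w∉)) (s-step v⇝w))
    traced-c (inj₂ (u , pu′ , v⇝u , j , inside , inj₁ refl)) =
      inj₂ (u , pu′ , v⇝u , j , inside , inj₂ (c-∈D (inside j ≤-refl)))
    traced-c (inj₂ (u , pu′ , v⇝u , j , inside , inj₂ refl)) =
      inj₂ (u , pu′ , v⇝u , j , inside ,
            inj₁ (trans (c-∈D (proj₂ (x-closed pz (inside j ≤-refl)))) (r-inv .involutive pz)))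
      where pz = rotate-present j (g-inv .closed (proj₁ (present′⁻ pu′)))

    traced-g : ∀ {v w} → Traced v w → Traced v (g K w)
    traced-g {v} {w} (inj₁ (pw′ , v⇝w)) with pw , w∉ ← present′⁻ pw′ | T? (inD (g K w))
    ... | yes gw∈ = inj₂ (w , pw′ , v⇝w , 0 , (λ { zero _ → gw∈ }) , inj₁ refl)
    ... | no  gw∉ = inj₁ ( present′⁺ (g-inv .closed pw) gw∉
                         , subst (Reach c′ newG v) (newG-exit {k = 0} pw w∉ ((λ _ ()) , gw∉)) (t-step v⇝w))
    traced-g {v} (inj₂ (u , pu′ , v⇝u , zero , _ , inj₁ refl)) =
      inj₁ (subst (T ∘ P′) (sym gg) pu′ , subst (Reach c′ newG v) (sym gg) v⇝u)
      where gg = g-inv .involutive (proj₁ (present′⁻ pu′))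
    traced-g (inj₂ (u , pu′ , v⇝u , suc j , inside , inj₁ refl)) =
      inj₂ (u , pu′ , v⇝u , j , (λ i i≤j → inside i (m≤n⇒m≤1+n i≤j)) ,
            inj₂ (g-inv .involutive (r-inv .closed (rotate-present j pgu))))
      where pgu = g-inv .closed (proj₁ (present′⁻ pu′))
    traced-g {v} (inj₂ (u , pu′ , v⇝u , j , inside , inj₂ refl))
      with pu , u∉ ← present′⁻ pu′ | T? (inD (fold (g K u) rotate (suc j)))
    ... | yes next∈ = inj₂ (u , pu′ , v⇝u , suc j , inside′ , inj₁ refl)
      where
      inside′ : ∀ i → i ≤ suc j → T (inD (fold (g K u) rotate i))
      inside′ i i≤1+j with m≤n⇒m<n∨m≡n i≤1+j
      ... | inj₁ i<1+j = inside i (≤-pred i<1+j)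
      ... | inj₂ refl  = next∈
    ... | no  next∉ = inj₁ ( present′⁺ (rotate-present (suc j) (g-inv .closed pu)) next∉
                           , subst (Reach c′ newG v)
                                   (newG-exit pu u∉ ((λ i i<1+j → inside i (≤-pred i<1+j)) , next∉))
                                   (t-step v⇝u))

    reach⇒traced : ∀ {v w} → T (P′ v) → Reach c (g K) v w → Traced v w
    reach⇒traced pv′ rfl          = inj₁ (pv′ , rfl)
    reach⇒traced pv′ (s-step v⇝w) = traced-c (reach⇒traced pv′ v⇝w)
    reach⇒traced pv′ (t-step v⇝w) = traced-g (reach⇒traced pv′ v⇝w)

    reach⇒reach′ : ∀ {v w} → T (P′ v) → T (P′ w) → Reach c (g K) v w → Reach c′ newG v w
    reach⇒reach′ pv′ pw′ v⇝w with reach⇒traced pv′ v⇝w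
    ... | inj₁ (_ , v⇝w′) = v⇝w′
    ... | inj₂ (u , pu′ , _ , j , inside , inj₁ refl) =
      ⊥-elim (proj₂ (present′⁻ pw′) (inside j ≤-refl))
    ... | inj₂ (u , pu′ , _ , j , inside , inj₂ refl) = ⊥-elim (proj₂ (present′⁻ pw′)
      (proj₂ (x-closed (rotate-present j (g-inv .closed (proj₁ (present′⁻ pu′)))) (inside j ≤-refl))))

    reach-gr⇒reach-cg : ∀ {v w} → (∀ {u} → Reach c (g K) v u → T (inD u)) →
                        Reach (g K) (r K) v w → Reach c (g K) v w
    reach-gr⇒reach-cg inside rfl          = rfl
    reach-gr⇒reach-cg inside (s-step v⇝w) = t-step (reach-gr⇒reach-cg inside v⇝w)
    reach-gr⇒reach-cg {v} inside (t-step v⇝w) = let v⇝w′ = reach-gr⇒reach-cg inside v⇝w in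
      subst (Reach c (g K) v) (c-∈D (inside v⇝w′)) (s-step v⇝w′)

    reach-cg⇒reach-gr : ∀ {v w} → (∀ {u} → Reach (g K) (r K) v u → T (inD u)) →
                        Reach c (g K) v w → Reach (g K) (r K) v w
    reach-cg⇒reach-gr inside rfl          = rfl
    reach-cg⇒reach-gr {v} inside (s-step v⇝w) = let v⇝w′ = reach-cg⇒reach-gr inside v⇝w in
      subst (Reach (g K) (r K) v) (sym (c-∈D (inside v⇝w′))) (t-step v⇝w′)
    reach-cg⇒reach-gr inside (t-step v⇝w) = s-step (reach-cg⇒reach-gr inside v⇝w)

    inside-cg : Fin n → Bool
    inside-cg v = all inD (cycleOf c (g K) v)

    inside-gr : Fin n → Bool
    inside-gr v = all inD (cycleOf (g K) (r K) v)

    -- A c–g cycle inside D is a g–r cycle, since c agrees with r on D.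
    isRep-inside : ∀ {v} → T (P v) → (inside-cg v ∧ isRep c (g K) v) ≡ (isRep (g K) (r K) v ∧ inside-gr v)
    isRep-inside pv = T-injective
      (λ h → let ins , rep = T-∧⁻ h
                 inside : ∀ {w} → Reach c (g K) _ w → T (inD w)
                 inside = CG.all-cycleOf⁻ inD pv ins
             in T-∧⁺ (least⇒isRep (CG.isRep⇒least pv rep ∘ reach-gr⇒reach-cg inside))
                     (all-cycleOf⁺ inD (inside ∘ reach-gr⇒reach-cg inside)))
      (λ h → let rep , ins = T-∧⁻ h
                 inside : ∀ {w} → Reach (g K) (r K) _ w → T (inD w)
                 inside = GR.all-cycleOf⁻ inD pv ins
             in T-∧⁺ (all-cycleOf⁺ inD (inside ∘ reach-cg⇒reach-gr inside))
                     (least⇒isRep (GR.isRep⇒least pv rep ∘ reach-cg⇒reach-gr inside)))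

    L = presentVs K

    reps-inside : length (filterᵇ (isRep c (g K)) (filterᵇ inside-cg L)) ≡ newIsolates
    reps-inside = begin
      length (filterᵇ (isRep c (g K)) (filterᵇ inside-cg L))
        ≡⟨ cong length (filterᵇ-filterᵇ inside-cg _ L) ⟩
      length (filterᵇ (λ v → inside-cg v ∧ isRep c (g K) v) L)
        ≡⟨ cong length (filterᵇ-cong L (isRep-inside ∘ ∈-presentVs⁻ K)) ⟩
      length (filterᵇ (λ v → isRep (g K) (r K) v ∧ inside-gr v) L)
        ≡⟨ cong length (filterᵇ-filterᵇ (isRep (g K) (r K)) inside-gr L) ⟨
      newIsolates
        ∎
      where open ≡-Reasoning

    sameCycle : Fin n → Fin n → Bool
    sameCycle = inCycle c (g K)

    sameCycle-equivalence : IsEquivalenceOn sameCycle L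
    sameCycle-equivalence = record
      { reflexive  = λ a∈ → CG.reach⇒inCycle (∈-presentVs⁻ K a∈) rfl
      ; symmetric  = λ a∈ b∈ ab → CG.reach⇒inCycle (∈-presentVs⁻ K b∈)
                                    (CG.reach-sym (∈-presentVs⁻ K a∈) (inCycle⇒reach ab))
      ; transitive = λ a∈ _ _ ab bc → CG.reach⇒inCycle (∈-presentVs⁻ K a∈)
                                        (reach-trans (inCycle⇒reach ab) (inCycle⇒reach bc)) }

    rep-not-inside : Fin n → Bool
    rep-not-inside v = not (inside-cg v) ∧ isRep c (g K) v

    rep′ : Fin n → Bool
    rep′ v = not (inD v) ∧ isRep c′ newG v

    rep-not-inside⁻ : ∀ {v} → T (rep-not-inside v) → ¬ T (inside-cg v) × T (isRep c (g K) v)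
    rep-not-inside⁻ {v} rep = let ¬ins , isrep = T-∧⁻ {not (inside-cg v)} rep in T-not⁻ ¬ins , isrep

    rep′⁻ : ∀ {v} → T (rep′ v) → ¬ T (inD v) × T (isRep c′ newG v)
    rep′⁻ {v} rep = let v∉ , isrep = T-∧⁻ {not (inD v)} rep in T-not⁻ v∉ , isrep

    module CycleClass {a} (a∈ : a ∈ L) where

      C = filterᵇ (sameCycle a) L
      pa = ∈-presentVs⁻ K a∈

      ∈C⁻ : ∀ {w} → w ∈ C → T (P w) × Reach c (g K) a w
      ∈C⁻ w∈ = let w∈L , a~w = ∈-filterᵇ⁻ (sameCycle a) w∈ in
               ∈-presentVs⁻ K w∈L , inCycle⇒reach a~w

      ∈C⁺ : ∀ {w} → T (P w) → Reach c (g K) a w → w ∈ C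
      ∈C⁺ pw a⇝w = ∈-filterᵇ⁺ (sameCycle a) (∈-presentVs⁺ K pw) (CG.reach⇒inCycle pa a⇝w)

      within : ∀ {v w} → v ∈ C → w ∈ C → Reach c (g K) v w
      within v∈ w∈ = reach-trans (CG.reach-sym pa (proj₂ (∈C⁻ v∈))) (proj₂ (∈C⁻ w∈))

      C-unique : Unique C
      C-unique = Unique.filter⁺ (T? ∘ sameCycle a) (presentVs-unique K)

      rep-not-inside-count : ∀ {w₀} → w₀ ∈ C → ¬ T (inD w₀) → length (filterᵇ rep-not-inside C) ≡ 1
      rep-not-inside-count w₀∈ w₀∉ with m , pm , rep , m⇝a ← CG.isRep-exists pa
                                 with m⇝w₀ ← reach-trans m⇝a (proj₂ (∈C⁻ w₀∈)) =
        length-filterᵇ≡1 rep-not-inside C-unique unique (∈C⁺ pm (CG.reach-sym pm m⇝a))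
          (T-∧⁺ (T-not⁺ λ inside → w₀∉ (CG.all-cycleOf⁻ inD pm inside m⇝w₀)) rep)
        where
        unique : ∀ {v w} → v ∈ C → w ∈ C → T (rep-not-inside v) → T (rep-not-inside w) → v ≡ w
        unique v∈ w∈ rep-v rep-w = CG.isRep-unique (proj₁ (∈C⁻ v∈)) (proj₁ (∈C⁻ w∈))
          (proj₂ (rep-not-inside⁻ rep-v)) (proj₂ (rep-not-inside⁻ rep-w)) (within v∈ w∈)

      rep′-count : ∀ {w₀} → w₀ ∈ C → ¬ T (inD w₀) → length (filterᵇ rep′ C) ≡ 1
      rep′-count w₀∈ w₀∉ with pw₀ , a⇝w₀ ← ∈C⁻ w₀∈
                          with m , pm′ , rep , m⇝w₀ ← C′G′.isRep-exists (present′⁺ pw₀ w₀∉)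
                          with pm ← proj₁ (present′⁻ pm′) =
        length-filterᵇ≡1 rep′ C-unique unique
          (∈C⁺ pm (reach-trans a⇝w₀ (CG.reach-sym pm (reach′⇒reach pm′ m⇝w₀))))
          (T-∧⁺ (T-not⁺ (proj₂ (present′⁻ pm′))) rep)
        where
        unique : ∀ {v w} → v ∈ C → w ∈ C → T (rep′ v) → T (rep′ w) → v ≡ w
        unique v∈ w∈ rep-v rep-w = C′G′.isRep-unique pv′ pw′
          (proj₂ (rep′⁻ rep-v)) (proj₂ (rep′⁻ rep-w)) (reach⇒reach′ pv′ pw′ (within v∈ w∈))
          where
          pv′ = present′⁺ (proj₁ (∈C⁻ v∈)) (proj₁ (rep′⁻ rep-v))
          pw′ = present′⁺ (proj₁ (∈C⁻ w∈)) (proj₁ (rep′⁻ rep-w))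

      count-inside : (∀ {w} → w ∈ C → T (inD w)) →
                     length (filterᵇ rep-not-inside C) ≡ length (filterᵇ rep′ C)
      count-inside inside = trans
        (length-filterᵇ≡0 rep-not-inside λ v∈ rep-v → proj₁ (rep-not-inside⁻ rep-v) (all-cycleOf⁺ inD λ v⇝w →
          let pv , a⇝v = ∈C⁻ v∈ in
          inside (∈C⁺ (CG.reach-present pv v⇝w) (reach-trans a⇝v v⇝w))))
        (sym (length-filterᵇ≡0 rep′ λ v∈ rep-v → proj₁ (rep′⁻ rep-v) (inside v∈)))

      same-count : length (filterᵇ rep-not-inside C) ≡ length (filterᵇ rep′ C)
      same-count with T? (any (not ∘ inD) C)
      ... | yes meets = let w₀ , w₀∈ , w₀∉ = find (Any.any⁻ _ C meets) in
        trans (rep-not-inside-count w₀∈ (T-not⁻ w₀∉)) (sym (rep′-count w₀∈ (T-not⁻ w₀∉)))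
      ... | no ¬meets = count-inside λ {w} w∈ → decidable-stable (T? (inD w)) λ w∉ →
        ¬meets (Any.any⁺ _ (lose w∈ (T-not⁺ w∉)))

    reps-not-inside : length (filterᵇ (isRep c (g K)) (filterᵇ (not ∘ inside-cg) L)) ≡
                   length (cycleReps K′ c′ newG)
    reps-not-inside = begin
      length (filterᵇ (isRep c (g K)) (filterᵇ (not ∘ inside-cg) L))
        ≡⟨ cong length (filterᵇ-filterᵇ _ _ L) ⟩
      length (filterᵇ rep-not-inside L)
        ≡⟨ length-filterᵇ-by-classes sameCycle rep-not-inside rep′ L sameCycle-equivalence CycleClass.same-count ⟩
      length (filterᵇ rep′ L)
        ≡⟨ cong length (filterᵇ-filterᵇ _ _ L) ⟨
      length (filterᵇ (isRep c′ newG) (filterᵇ (not ∘ inD) L))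
        ≡⟨ cong (length ∘ filterᵇ (isRep c′ newG)) (filterᵇ-filterᵇ P (not ∘ inD) (allFin n)) ⟩
      length (cycleReps K′ c′ newG)
        ∎
      where open ≡-Reasoning

    cycles-deleteHyperedge : length (cycleReps K′ c′ newG) + newIsolates ≡ length (cycleReps K c (g K))
    cycles-deleteHyperedge = begin
      length (cycleReps K′ c′ newG) + newIsolates  ≡⟨ +-comm _ newIsolates ⟩
      newIsolates + length (cycleReps K′ c′ newG)  ≡⟨ cong₂ _+_ reps-inside reps-not-inside ⟨
      length (filterᵇ (isRep c (g K)) (filterᵇ inside-cg L)) +
      length (filterᵇ (isRep c (g K)) (filterᵇ (not ∘ inside-cg) L))
                                                   ≡⟨ length-filterᵇ-split inside-cg (isRep c (g K)) L ⟨
      length (cycleReps K c (g K))                 ∎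
      where open ≡-Reasoning

-- Deleting several hyperedges

AllClosed : ∀ {n} → RawGehm n → List (Fin n) → Set
AllClosed K xs = ∀ {x} → x ∈ xs → HyperedgeClosed K x

switchOn : ∀ {n} → (B R : Fin n → Fin n) → List (Fin n) → (Fin n → Fin n) → Fin n → Fin n
switchOn B R []       c′   = c′
switchOn B R (x ∷ xs) c′ v = if inCycle B R x v then R v else switchOn B R xs c′ v

switchOn-value : ∀ {n} (B R : Fin n → Fin n) xs c′ v →
  switchOn B R xs c′ v ≡ (if any (λ x → inCycle B R x v) xs then R v else c′ v)
switchOn-value B R []       c′ v = refl
switchOn-value B R (x ∷ xs) c′ v with inCycle B R x v
... | true  = refl
... | false = switchOn-value B R xs c′ v

module _ {n : ℕ} where

  hyperedgeClosed-deleteHyperedge : ∀ (K : RawGehm n) {x} y → HyperedgeClosed K x →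
                                    HyperedgeClosed (deleteHyperedge K y) x
  hyperedgeClosed-deleteHyperedge K {x} y closed {w} pw′ = closed (proj₁ (T-∧⁻ {present K w} pw′))

  allClosed-tail : ∀ (K : RawGehm n) {x xs} → AllClosed K (x ∷ xs) → AllClosed (deleteHyperedge K x) xs
  allClosed-tail K {x} closed x′∈ = hyperedgeClosed-deleteHyperedge K x (closed (there x′∈))

  b-deleteHyperedges : ∀ (K : RawGehm n) xs → b (deleteHyperedges K xs) ≡ b K
  b-deleteHyperedges K []       = refl
  b-deleteHyperedges K (x ∷ xs) = b-deleteHyperedges (deleteHyperedge K x) xs

  isPregehm-deleteHyperedges : ∀ {K : RawGehm n} → IsPregehm K → ∀ xs → AllClosed K xs →
                               IsPregehm (deleteHyperedges K xs)
  isPregehm-deleteHyperedges pre []       _      = pre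
  isPregehm-deleteHyperedges {K} pre (x ∷ xs) closed = isPregehm-deleteHyperedges
    (DeleteOne.isPregehm′ K pre x (closed (here refl))) xs (allClosed-tail K closed)

  switchOn-involution : ∀ {K : RawGehm n} → IsPregehm K → ∀ xs → AllClosed K xs → ∀ {c′} →
                        InvolutionOn (present (deleteHyperedges K xs)) c′ →
                        InvolutionOn (present K) (switchOn (b K) (r K) xs c′)
  switchOn-involution pre []       _      c′-inv = c′-inv
  switchOn-involution {K} pre (x ∷ xs) closed c′-inv = Splice.c-inv _ (switchOn-involution
    isPregehm′ xs (allClosed-tail K closed) c′-inv)
    where open DeleteOne K pre x (closed (here refl))

  switchOn-b-involution : ∀ {K : RawGehm n} → IsPregehm K → ∀ xs → AllClosed K xs →
                          InvolutionOn (present K) (switchOn (b K) (r K) xs (b K))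
  switchOn-b-involution {K} pre xs closed =
    subst (λ c′ → InvolutionOn (present K) (switchOn (b K) (r K) xs c′)) (b-deleteHyperedges K xs)
          (switchOn-involution pre xs closed (IsPregehm.b-inv (isPregehm-deleteHyperedges pre xs closed)))

  cycles-deleteHyperedges : ∀ {K : RawGehm n} → IsPregehm K → ∀ xs → AllClosed K xs → ∀ {c′} →
    InvolutionOn (present (deleteHyperedges K xs)) c′ →
    length (cycleReps (deleteHyperedges K xs) c′ (g (deleteHyperedges K xs))) + isolates (deleteHyperedges K xs)
      ≡ length (cycleReps K (switchOn (b K) (r K) xs c′) (g K)) + isolates K
  cycles-deleteHyperedges pre [] _ _ = refl
  cycles-deleteHyperedges {K} pre (x ∷ xs) closed {c′} c′-inv = begin
      length (cycleReps K″ c′ (g K″)) + isolates K″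
    ≡⟨ cycles-deleteHyperedges isPregehm′ xs closed′ c′-inv ⟩
      length (cycleReps K′ c″ (g K′)) + (isolates K + newIsolates)
    ≡⟨ cong (length (cycleReps K′ c″ (g K′)) +_) (+-comm (isolates K) newIsolates) ⟩
      length (cycleReps K′ c″ (g K′)) + (newIsolates + isolates K)
    ≡⟨ +-assoc (length (cycleReps K′ c″ (g K′))) newIsolates (isolates K) ⟨
      length (cycleReps K′ c″ (g K′)) + newIsolates + isolates K
    ≡⟨ cong (_+ isolates K) (Splice.cycles-deleteHyperedge c″ c″-inv) ⟩
      length (cycleReps K (switchOn (b K) (r K) (x ∷ xs) c′) (g K)) + isolates K
    ∎
    where
    open ≡-Reasoning
    open DeleteOne K pre x (closed (here refl))
    closed′ = allClosed-tail K closed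
    K″ = deleteHyperedges K′ xs
    c″ = switchOn (b K) (r K) xs c′
    c″-inv = switchOn-involution isPregehm′ xs closed′ c′-inv

  hyperfaces-deleteHyperedges : ∀ {K : RawGehm n} → IsPregehm K → ∀ xs → AllClosed K xs →
    f K xs ≡ length (cycleReps K (switchOn (b K) (r K) xs (b K)) (g K)) + isolates K
  hyperfaces-deleteHyperedges {K} pre xs closed = begin
      f K xs
    ≡⟨ cycles-deleteHyperedges pre xs closed (IsPregehm.b-inv (isPregehm-deleteHyperedges pre xs closed)) ⟩
      length (cycleReps K (switchOn (b K) (r K) xs (b (deleteHyperedges K xs))) (g K)) + isolates K
    ≡⟨ cong (λ c′ → length (cycleReps K (switchOn (b K) (r K) xs c′) (g K)) + isolates K)
            (b-deleteHyperedges K xs) ⟩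
      length (cycleReps K (switchOn (b K) (r K) xs (b K)) (g K)) + isolates K
    ∎
    where open ≡-Reasoning

-- Sums and powers

dSet≡sum : ∀ {n} (K : RawGehm n) A → dSet K A ≡ sum (map (dₑ K) A)
dSet≡sum K []      = refl
dSet≡sum K (x ∷ A) = cong (dₑ K x +_) (dSet≡sum K A)

dSet-↭ : ∀ {n} (K : RawGehm n) {A C xs} → A ++ C ↭ xs → dSet K A + dSet K C ≡ dSet K xs
dSet-↭ K {A} {C} {xs} A++C↭xs = begin
  dSet K A + dSet K C                          ≡⟨ cong₂ _+_ (dSet≡sum K A) (dSet≡sum K C) ⟩
  sum (map (dₑ K) A) + sum (map (dₑ K) C)      ≡⟨ sum-++ (map (dₑ K) A) (map (dₑ K) C) ⟨
  sum (map (dₑ K) A ++ map (dₑ K) C)           ≡⟨ cong sum (map-++ (dₑ K) A C) ⟨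
  sum (map (dₑ K) (A ++ C))                    ≡⟨ sum-↭ (↭.map⁺ (dₑ K) A++C↭xs) ⟩
  sum (map (dₑ K) xs)                          ≡⟨ dSet≡sum K xs ⟨
  dSet K xs                                    ∎
  where open ≡-Reasoning

[m+n]∸[o+p]≡[m∸o]+[n∸p] : ∀ {m n o p} → o ≤ m → p ≤ n →
                          (m + n) ∸ (o + p) ≡ (m ∸ o) + (n ∸ p)
[m+n]∸[o+p]≡[m∸o]+[n∸p] {m} {n} {o} {p} o≤m p≤n = begin
  (m + n) ∸ (o + p)    ≡⟨ ∸-+-assoc (m + n) o p ⟨
  (m + n) ∸ o ∸ p      ≡⟨ cong (_∸ p) (+-∸-comm n o≤m) ⟩
  (m ∸ o + n) ∸ p      ≡⟨ +-∸-assoc (m ∸ o) p≤n ⟩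
  (m ∸ o) + (n ∸ p)    ∎
  where open ≡-Reasoning

^-+ : ∀ p m k → p ^ (m + k) ≡ p ^ m * p ^ k
^-+ p zero    k = sym (ℚ.*-identityˡ _)
^-+ p (suc m) k = trans (cong (p *_) (^-+ p m k)) (sym (ℚ.*-assoc p _ _))

^-*-1/^≡1 : ∀ p .{{_ : NonZero p}} k → p ^ k * (1/ p) ^ k ≡ 1ℚ
^-*-1/^≡1 p zero    = ℚ.*-identityˡ 1ℚ
^-*-1/^≡1 p (suc k) = begin
  (p * p ^ k) * ((1/ p) * (1/ p) ^ k)    ≡⟨ interchange p (p ^ k) (1/ p) ((1/ p) ^ k) ⟩
  (p * 1/ p) * (p ^ k * (1/ p) ^ k)      ≡⟨ cong₂ _*_ (ℚ.*-inverseʳ p) (^-*-1/^≡1 p k) ⟩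
  1ℚ * 1ℚ                                ≡⟨ ℚ.*-identityˡ 1ℚ ⟩
  1ℚ                                     ∎
  where open ≡-Reasoning

^-*-1/^ : ∀ p .{{_ : NonZero p}} a c q → p ^ a * q ≡ p ^ (a + c) * ((1/ p) ^ c * q)
^-*-1/^ p a c q = sym (begin
  p ^ (a + c) * ((1/ p) ^ c * q)          ≡⟨ cong (_* ((1/ p) ^ c * q)) (^-+ p a c) ⟩
  (p ^ a * p ^ c) * ((1/ p) ^ c * q)      ≡⟨ ℚ.*-assoc (p ^ a) (p ^ c) _ ⟩
  p ^ a * (p ^ c * ((1/ p) ^ c * q))      ≡⟨ cong (p ^ a *_) (ℚ.*-assoc (p ^ c) ((1/ p) ^ c) q) ⟨
  p ^ a * ((p ^ c * (1/ p) ^ c) * q)      ≡⟨ cong (λ r → p ^ a * (r * q)) (^-*-1/^≡1 p c) ⟩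
  p ^ a * (1ℚ * q)                        ≡⟨ cong (p ^ a *_) (ℚ.*-identityˡ q) ⟩
  p ^ a * q                               ∎)
  where open ≡-Reasoning

Σℚ : (A → ℚ) → List A → ℚ
Σℚ F xs = foldr _+ℚ_ 0ℚ (map F xs)

Σℚ-++ : ∀ (F : A → ℚ) xs ys → Σℚ F (xs ++ ys) ≡ Σℚ F xs +ℚ Σℚ F ys
Σℚ-++ F []       ys = sym (ℚ.+-identityˡ _)
Σℚ-++ F (x ∷ xs) ys = trans (cong (F x +ℚ_) (Σℚ-++ F xs ys)) (sym (ℚ.+-assoc (F x) _ _))

Σℚ-map : ∀ {B : Set} (F : A → ℚ) (h : B → A) ys → Σℚ F (map h ys) ≡ Σℚ (F ∘ h) ys
Σℚ-map F h []       = refl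
Σℚ-map F h (y ∷ ys) = cong (F (h y) +ℚ_) (Σℚ-map F h ys)

Σℚ-cong : ∀ {F G : A → ℚ} xs → (∀ {x} → x ∈ xs → F x ≡ G x) → Σℚ F xs ≡ Σℚ G xs
Σℚ-cong []       _   = refl
Σℚ-cong (x ∷ xs) F≡G = cong₂ _+ℚ_ (F≡G (here refl)) (Σℚ-cong xs (F≡G ∘ there))

*-Σℚ : ∀ (k : ℚ) (F : A → ℚ) xs → k * Σℚ F xs ≡ Σℚ ((k *_) ∘ F) xs
*-Σℚ k F []       = ℚ.*-zeroʳ k
*-Σℚ k F (x ∷ xs) = trans (ℚ.*-distribˡ-+ k (F x) _) (cong (k * F x +ℚ_) (*-Σℚ k F xs))

Σℚ-swap : ∀ (F : List A × List A → ℚ) xs →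
          Σℚ F (subsetsWithComplement xs) ≡ Σℚ (F ∘ swap) (subsetsWithComplement xs)
Σℚ-swap F []       = refl
Σℚ-swap F (x ∷ xs) = begin
    Σℚ F (map withx S ++ map xwith S)
      ≡⟨ Σℚ-++ F (map withx S) (map xwith S) ⟩
    Σℚ F (map withx S) +ℚ Σℚ F (map xwith S)
      ≡⟨ cong₂ _+ℚ_ (Σℚ-map F withx S) (Σℚ-map F xwith S) ⟩
    Σℚ (F ∘ withx) S +ℚ Σℚ (F ∘ xwith) S
      ≡⟨ ℚ.+-comm (Σℚ (F ∘ withx) S) _ ⟩
    Σℚ (F ∘ xwith) S +ℚ Σℚ (F ∘ withx) S
      ≡⟨ cong₂ _+ℚ_ (Σℚ-swap (F ∘ xwith) xs) (Σℚ-swap (F ∘ withx) xs) ⟩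
    Σℚ (F ∘ swap ∘ withx) S +ℚ Σℚ (F ∘ swap ∘ xwith) S
      ≡⟨ cong₂ _+ℚ_ (Σℚ-map (F ∘ swap) withx S) (Σℚ-map (F ∘ swap) xwith S) ⟨
    Σℚ (F ∘ swap) (map withx S) +ℚ Σℚ (F ∘ swap) (map xwith S)
      ≡⟨ Σℚ-++ (F ∘ swap) (map withx S) (map xwith S) ⟨
    Σℚ (F ∘ swap) (map withx S ++ map xwith S)
      ∎
  where
  open ≡-Reasoning
  S = subsetsWithComplement xs
  withx xwith : List _ × List _ → List _ × List _
  withx (A , C) = (x ∷ A , C)
  xwith (A , C) = (A , x ∷ C)

term : ∀ {n} → RawGehm n → ℚ → ℚ → List (Fin n) × List (Fin n) → ℚ
term K u v (A , Ac) = u ^ (dSet K A ∸ length A) * v ^ f K Ac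

-- Duality

module Duality {n : ℕ} (H : RawGehm n) (isGehm : IsGehm H) where

  pre : IsPregehm H
  pre = isGehm⇒isPregehm isGehm

  open IsPregehm pre

  H* = dual H

  pre* : IsPregehm H*
  pre* = record { b-inv = r-inv ; g-inv = g-inv ; r-inv = b-inv }

  P = present H
  L = presentVs H
  E = hyperedges H

  module BR = Orbits b-inv r-inv

  ∈E⇒present : ∀ {x} → x ∈ E → T (P x)
  ∈E⇒present = ∈-presentVs⁻ H ∘ proj₁ ∘ ∈-filterᵇ⁻ (isRep (b H) (r H)) {xs = L}

  hyperedges-dual : hyperedges H* ≡ E
  hyperedges-dual = filterᵇ-cong L (isRep-swap b-inv r-inv ∘ ∈-presentVs⁻ H)

  dSet-dual : ∀ A → (∀ {x} → x ∈ A → x ∈ E) → dSet H* A ≡ dSet H A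
  dSet-dual []      _   = refl
  dSet-dual (x ∷ A) A⊆E = cong₂ _+_
    (cong (λ m → length m / 2) (filterᵇ-cong L λ _ → inCycle-swap b-inv r-inv (∈E⇒present (A⊆E (here refl)))))
    (dSet-dual A (A⊆E ∘ there))

  1≤dₑ : ∀ {x} → x ∈ E → 1 ≤ dₑ H x
  1≤dₑ {x} x∈ = m≥n⇒m/n>0 (2≤length
    (∈-filterᵇ⁺ (inCycle (b H) (r H) x) (∈-presentVs⁺ H px) (BR.reach⇒inCycle px rfl))
    (∈-filterᵇ⁺ (inCycle (b H) (r H) x) (∈-presentVs⁺ H (b-inv .closed px))
                (BR.reach⇒inCycle px (s-step rfl)))
    (IsGehm.b-nofix isGehm x px ∘ sym))
    where
    open InvolutionOn
    px = ∈E⇒present x∈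

  length≤dSet : ∀ A → (∀ {x} → x ∈ A → x ∈ E) → length A ≤ dSet H A
  length≤dSet []      _   = z≤n
  length≤dSet (x ∷ A) A⊆E = +-mono-≤ (1≤dₑ (A⊆E (here refl))) (length≤dSet A (A⊆E ∘ there))

  contains : Fin n → Fin n → Bool
  contains v x = inCycle (b H) (r H) x v

  hyperedge-unique : ∀ {v} → T (P v) → length (filterᵇ (contains v) E) ≡ 1
  hyperedge-unique {v} pv with m , pm , rep , m⇝v ← BR.isRep-exists pv =
    length-filterᵇ≡1 (contains v) (Unique.filter⁺ (T? ∘ isRep (b H) (r H)) (presentVs-unique H))
      unique (∈-filterᵇ⁺ (isRep (b H) (r H)) (∈-presentVs⁺ H pm) rep) (BR.reach⇒inCycle pm m⇝v)
    where
    isRep-E : ∀ {x} → x ∈ E → T (isRep (b H) (r H) x)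
    isRep-E = proj₂ ∘ ∈-filterᵇ⁻ (isRep (b H) (r H)) {xs = L}
    unique : ∀ {x y} → x ∈ E → y ∈ E → T (contains v x) → T (contains v y) → x ≡ y
    unique x∈ y∈ x∋v y∋v = BR.isRep-unique px py (isRep-E x∈) (isRep-E y∈)
      (reach-trans (inCycle⇒reach x∋v) (BR.reach-sym py (inCycle⇒reach y∋v)))
      where
      px = ∈E⇒present x∈
      py = ∈E⇒present y∈

  module Complementary {A C} (A,C∈ : (A , C) ∈ subsetsWithComplement E) where

    A++C↭E : A ++ C ↭ E
    A++C↭E = subsetsWithComplement-↭ E A,C∈

    A⊆E : ∀ {x} → x ∈ A → x ∈ E
    A⊆E x∈ = ↭.∈-resp-↭ A++C↭E (∈-++⁺ˡ x∈)

    C⊆E : ∀ {x} → x ∈ C → x ∈ E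
    C⊆E x∈ = ↭.∈-resp-↭ A++C↭E (∈-++⁺ʳ A x∈)

    partition : ∀ {v} → T (P v) → any (contains v) A ≡ not (any (contains v) C)
    partition {v} pv = begin
      any (contains v) A                          ≡⟨ any-filterᵇ (contains v) A ⟩
      0 <ᵇ length (filterᵇ (contains v) A)        ≡⟨ 0<ᵇ-complement (length (filterᵇ (contains v) A)) _ counts ⟩
      not (0 <ᵇ length (filterᵇ (contains v) C))  ≡⟨ cong not (any-filterᵇ (contains v) C) ⟨
      not (any (contains v) C)                    ∎
      where
      open ≡-Reasoning
      counts = trans (length-filterᵇ-↭ (contains v) {A} {C} A++C↭E) (hyperedge-unique pv)

    -- Deleting C from H and A from H* both switch b to r exactly on the hyperedges in C.
    switches-agree : ∀ {u} → T (P u) → switchOn (b H) (r H) C (b H) u ≡ switchOn (r H) (b H) A (r H) u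
    switches-agree {u} pu = begin
      switchOn (b H) (r H) C (b H) u
        ≡⟨ switchOn-value (b H) (r H) C (b H) u ⟩
      (if any (contains u) C then r H u else b H u)
        ≡⟨ if-not (any (contains u) C) ⟨
      (if not (any (contains u) C) then b H u else r H u)
        ≡⟨ cong (if_then b H u else r H u) (partition pu) ⟨
      (if any (contains u) A then b H u else r H u)
        ≡⟨ cong (if_then b H u else r H u) (any-cong A λ x∈ → inCycle-swap b-inv r-inv (∈E⇒present (A⊆E x∈))) ⟨
      (if any (λ x → inCycle (r H) (b H) x u) A then b H u else r H u)
        ≡⟨ switchOn-value (r H) (b H) A (r H) u ⟨
      switchOn (r H) (b H) A (r H) u
        ∎
      where open ≡-Reasoning

    hyperfaces-complement : f H C ≡ f H* A
    hyperfaces-complement = begin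
      f H C
        ≡⟨ hyperfaces-deleteHyperedges pre C (hyperedgeClosed pre ∘ ∈E⇒present ∘ C⊆E) ⟩
      length (filterᵇ (isRep (switchOn (b H) (r H) C (b H)) (g H)) L) + isolates H
        ≡⟨ cong (λ xs → length xs + isolates H)
                (filterᵇ-cong L (isRep-cong switchC-inv switchA-inv g-inv switches-agree ∘ ∈-presentVs⁻ H)) ⟩
      length (filterᵇ (isRep (switchOn (r H) (b H) A (r H)) (g H)) L) + isolates H
        ≡⟨ hyperfaces-deleteHyperedges pre* A (hyperedgeClosed pre* ∘ ∈E⇒present ∘ A⊆E) ⟨
      f H* A
        ∎
      where
      open ≡-Reasoning
      switchC-inv = switchOn-b-involution pre C (hyperedgeClosed pre ∘ ∈E⇒present ∘ C⊆E)
      switchA-inv = switchOn-b-involution pre* A (hyperedgeClosed pre* ∘ ∈E⇒present ∘ A⊆E)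

    -- ∸ truncates; it is exact here because |A| ≤ d(A), b having no fixed points.
    exponent-split : d H ∸ e H ≡ (dSet H A ∸ length A) + (dSet H C ∸ length C)
    exponent-split = begin
      d H ∸ e H
        ≡⟨ cong₂ _∸_ (dSet-↭ H {A} {C} A++C↭E) (trans (sym (length-++ A)) (↭-length A++C↭E)) ⟨
      (dSet H A + dSet H C) ∸ (length A + length C)
        ≡⟨ [m+n]∸[o+p]≡[m∸o]+[n∸p] (length≤dSet A A⊆E) (length≤dSet C C⊆E) ⟩
      (dSet H A ∸ length A) + (dSet H C ∸ length C)
        ∎
      where open ≡-Reasoning

    term-duality : ∀ (u v : ℚ) .{{_ : NonZero u}} →
                   term H u v (A , C) ≡ u ^ (d H ∸ e H) * term H* (1/ u) v (C , A)
    term-duality u v = begin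
      u ^ (dSet H A ∸ length A) * v ^ f H C
        ≡⟨ ^-*-1/^ u (dSet H A ∸ length A) (dSet H C ∸ length C) _ ⟩
      u ^ ((dSet H A ∸ length A) + (dSet H C ∸ length C)) * ((1/ u) ^ (dSet H C ∸ length C) * v ^ f H C)
        ≡⟨ cong₂ (λ k l → u ^ k * ((1/ u) ^ (l ∸ length C) * v ^ f H C))
                 exponent-split (dSet-dual C C⊆E) ⟨
      u ^ (d H ∸ e H) * ((1/ u) ^ (dSet H* C ∸ length C) * v ^ f H C)
        ≡⟨ cong (λ m → u ^ (d H ∸ e H) * ((1/ u) ^ (dSet H* C ∸ length C) * v ^ m))
                hyperfaces-complement ⟩
      u ^ (d H ∸ e H) * ((1/ u) ^ (dSet H* C ∸ length C) * v ^ f H* A)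
        ∎
      where open ≡-Reasoning

corollary2 : (n : ℕ) (H : RawGehm n) → IsGehm H →
    (u v : ℚ) .{{_ : NonZero u}} →
    Z H u v ≡ (u ^ (d H ∸ e H)) * Z (dual H) (1/ u) v
corollary2 n H isGehm u v = begin
    Z H u v
      ≡⟨ Σℚ-cong S (λ A,C∈ → Complementary.term-duality A,C∈ u v) ⟩
    Σℚ (λ p → u ^ k * term H* (1/ u) v (swap p)) S
      ≡⟨ Σℚ-swap (λ p → u ^ k * term H* (1/ u) v p) E ⟨
    Σℚ (λ p → u ^ k * term H* (1/ u) v p) S
      ≡⟨ *-Σℚ (u ^ k) (term H* (1/ u) v) S ⟨
    u ^ k * Σℚ (term H* (1/ u) v) S
      ≡⟨ cong (λ xs → u ^ k * Σℚ (term H* (1/ u) v) (subsetsWithComplement xs)) hyperedges-dual ⟨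
    u ^ k * Z H* (1/ u) v
      ∎
  where
  open Duality H isGehm
  open ≡-Reasoning
  k = d H ∸ e H
  S = subsetsWithComplement E
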